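{- For all positive integers $q$ and $r$, the winding permutation $3$--hypergraph $W_{q,r}$ satisfies $\omega(W_{q,r})=q$.
   Context: A cyclic permutation of $\{1,\dots,n\}$ is a class $[\phi]$ of bijections $\phi:\{1,\dots,n\}\to\{1,\dots,n\}$ modulo cyclic rotation ($\phi\sim\psi$ iff there is $k$ with $\phi(i)=\psi(i+k)$ for all $i$, indices mod $n$). Elements $i<j<k$ are in clockwise order with respect to $[\phi]$ if some $\psi\in[\phi]$ has $\psi^{ -1}(i)<\psi^{ -1}(j)<\psi^{ -1}(k)$. The $3$--hypergraph associated to $[\phi]$ has vertex set $\{1,\dots,n\}$ and edges the triples $\{i,j,k\}$, $i<j<k$, in clockwise order with respect to $[\phi]$. For positive integers $q,r$, let $n=r(q-1)+1$ and define $\phi_{q,r}:\{1,\dots,n\}\to\{1,\dots,n\}$ by $\phi_{q,r}(n)=1$ and, for $1\le i<n$ with $i\equiv j \pmod r$, $1\le j\le r$, $\phi_{q,r}(i)=2+(q-1)(r-j)+\frac{i-j}{r}$. $W_{q,r}$ is the $3$--hypergraph associated to $[\phi_{q,r}]$ (e.g. for $q=5,r=3$ the permutation is $(10\,6\,2\,11\,7\,3\,12\,8\,4\,13\,9\,5\,1)$). The clique number $\omega(H)$ of a $3$--hypergraph is the largest size of a vertex subset all of whose $3$-subsets are edges. -}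

module Defs where

open import Data.Nat using (ℕ; zero; suc; _≟_; _+_; _*_; _∸_; _≤_; _<_; NonZero)
open import Data.Nat.DivMod using (_/_; _%_)
open import Data.Product using (Σ; _×_; ∃-syntax)
open import Data.List using (List; length)
open import Data.List.Membership.Propositional using (_∈_)
open import Data.List.Relation.Unary.All using (All)
open import Data.List.Relation.Unary.Unique.Propositional using (Unique)
open import Relation.Binary.PropositionalEquality using (_≡_)
open import Relation.Nullary using (yes; no)

size : ℕ → ℕ → ℕ
size q r = suc (r * (q ∸ 1))

-- the winding permutation φ_{q,r} on {1,…,n}, given as a function on ℕ
-- (values outside 1..n are irrelevant).
phi : (q r : ℕ) → .{{NonZero r}} → ℕ → ℕ
phi q r i with i ≟ size q r
... | yes _ = 1
... | no _ =
  let j = suc ((i ∸ 1) % r) in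
  2 + (q ∸ 1) * (r ∸ j) + (i ∸ j) / r

-- the rotation ψ_s of φ by s: ψ_s(m) = φ(m+s), indices taken mod n in {1..n}
rot : (q r : ℕ) → .{{NonZero r}} → ℕ → ℕ → ℕ
rot q r s m = phi q r (suc ((m ∸ 1 + s) % size q r))

-- i < j < k are in clockwise order w.r.t. [φ_{q,r}]: some rotation ψ of φ
-- has ψ⁻¹(i) < ψ⁻¹(j) < ψ⁻¹(k), i.e. positions 1 ≤ a < b < c ≤ n with
-- ψ(a) = i, ψ(b) = j, ψ(c) = k.
Clockwise : (q r : ℕ) → .{{NonZero r}} → ℕ → ℕ → ℕ → Set
Clockwise q r i j k =
  Σ ℕ λ s → Σ ℕ λ a → Σ ℕ λ b → Σ ℕ λ c →
    (1 ≤ a) × (a < b) × (b < c) × (c ≤ size q r) ×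
    (rot q r s a ≡ i) × (rot q r s b ≡ j) × (rot q r s c ≡ k)

IsVertex : ℕ → ℕ → ℕ → Set
IsVertex q r v = (1 ≤ v) × (v ≤ size q r)

Edge : (q r : ℕ) → .{{NonZero r}} → ℕ → ℕ → ℕ → Set
Edge q r i j k = (i < j) × (j < k) × IsVertex q r i × IsVertex q r k × Clockwise q r i j k

IsClique : (q r : ℕ) → .{{NonZero r}} → List ℕ → Set
IsClique q r S =
  Unique S × All (IsVertex q r) S ×
  (∀ {i j k} → i ∈ S → j ∈ S → k ∈ S → i < j → j < k → Edge q r i j k)

CliqueNumberIs : (q r : ℕ) → .{{NonZero r}} → ℕ → Set
CliqueNumberIs q r w =
  (Σ (List ℕ) λ S → IsClique q r S × (length S ≡ w)) ×
  (∀ S → IsClique q r S → length S ≤ w)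

-- Read φ_{q,r} as a word: its first r(q − 1) letters form q − 1 rounds of r consecutive
-- letters, the values decrease inside each round, and the last letter is 1.  The values
-- 2, …, q end the rounds, so read cyclically from the final 1 they appear as 1, 2, …, q:
-- a clique of size q.  Conversely the positions of a clique v₁ < ⋯ < vₘ are cyclically
-- increasing, so the clique splits into an unwrapped initial part with increasing
-- positions and a wrapped final part placed before it.  Within each part the rounds
-- strictly increase, and wrapped vertices lie in rounds no later than unwrapped ones, so
-- "round, plus one if unwrapped" (and q − 1 for the vertex 1) is an injection into [0, q).

module Submission where

open import Defs
open import Data.Nat using (ℕ; _≤_; NonZero)
open import Data.Nat.Base using (zero; suc; _+_; _*_; _∸_; _<_; z≤n; s≤s; s<s⁻¹)
open import Data.Nat.Properties
open import Data.Nat.DivMod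
open import Data.Nat.Divisibility using (divides)
open import Data.Fin using (Fin; fromℕ<)
import Data.Fin.Properties as Fin
open import Data.Product using (Σ; _×_; _,_; proj₁; proj₂)
open import Data.Sum using (_⊎_; inj₁; inj₂)
open import Function using (_∘_)
open import Relation.Nullary using (¬_; Dec; yes; no; contradiction)
open import Relation.Nullary.Decidable using (_×-dec_)
open import Relation.Binary.Definitions using (tri<; tri≈; tri>)
open import Relation.Binary.PropositionalEquality
open import Data.List using (List; _∷_; length; lookup; applyDownFrom)
open import Data.List.Properties using (length-applyDownFrom)
import Data.List.Relation.Unary.All as All
open import Data.List.Relation.Unary.AllPairs using (_∷_)
open import Data.List.Relation.Unary.Unique.Propositional using (Unique)
open import Data.List.Relation.Unary.Unique.Propositional.Properties using (applyDownFrom⁺₁)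
open import Data.List.Relation.Unary.Any using (Any; any?)
open import Data.List.Membership.Propositional using (_∈_; find; lose)
open import Data.List.Membership.Propositional.Properties using (∈-lookup; ∈-applyDownFrom⁻)

private variable
  m p p′ x y z x′ y′ z′ : ℕ

m<n⇒[m+kn]%n≡m : ∀ {n} k .{{_ : NonZero n}} → m < n → (m + k * n) % n ≡ m
m<n⇒[m+kn]%n≡m {m} {n} k m<n = trans ([m+kn]%n≡m%n m k n) (m<n⇒m%n≡m m<n)

m<n⇒[m+kn]/n≡k : ∀ {n} k .{{_ : NonZero n}} → m < n → (m + k * n) / n ≡ k
m<n⇒[m+kn]/n≡k {m} {n} k m<n = begin
  (m + k * n) / n      ≡⟨ +-distrib-/-∣ʳ m (divides k refl) ⟩
  m / n + k * n / n    ≡⟨ cong₂ _+_ (m<n⇒m/n≡0 m<n) (m*n/n≡m k n) ⟩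
  k                    ∎
  where open ≡-Reasoning

lookup-injective : ∀ {A : Set} {xs : List A} → Unique xs → ∀ i j → lookup xs i ≡ lookup xs j → i ≡ j
lookup-injective (_ ∷ _) Fin.zero Fin.zero _ = refl
lookup-injective (x∉ ∷ _) Fin.zero (Fin.suc j) e = contradiction e (All.lookup x∉ (∈-lookup j))
lookup-injective (x∉ ∷ _) (Fin.suc i) Fin.zero e = contradiction (sym e) (All.lookup x∉ (∈-lookup i))
lookup-injective (_ ∷ u) (Fin.suc i) (Fin.suc j) e = cong Fin.suc (lookup-injective u i j e)

length≤-of-injectiveOn : ∀ {A : Set} {xs : List A} {B} (f : A → ℕ) → Unique xs →
                         (∀ {x} → x ∈ xs → f x < B) →
                         (∀ {x y} → x ∈ xs → y ∈ xs → f x ≡ f y → x ≡ y) →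
                         length xs ≤ B
length≤-of-injectiveOn {xs = xs} {B} f unique f<B f-injective = Fin.injective⇒≤ g-injective
  where
  g : Fin (length xs) → Fin B
  g i = fromℕ< (f<B (∈-lookup i))
  g-injective : ∀ {i j} → g i ≡ g j → i ≡ j
  g-injective {i} {j} e = lookup-injective unique i j
    (f-injective (∈-lookup i) (∈-lookup j) (Fin.fromℕ<-injective _ _ _ _ e))

CyclicOrder : ℕ → ℕ → ℕ → Set
CyclicOrder x y z = (x < y × y < z) ⊎ (y < z × z < x) ⊎ (z < x × x < y)

CyclicOrder-asym : CyclicOrder x y z → ¬ CyclicOrder z y x
CyclicOrder-asym (inj₁ (_ , y<z))        (inj₁ (z<y , _))        = <-asym y<z z<y
CyclicOrder-asym (inj₁ (x<y , _))        (inj₂ (inj₁ (y<x , _))) = <-asym x<y y<x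
CyclicOrder-asym (inj₁ (_ , y<z))        (inj₂ (inj₂ (_ , z<y))) = <-asym y<z z<y
CyclicOrder-asym (inj₂ (inj₁ (y<z , _))) (inj₁ (z<y , _))        = <-asym y<z z<y
CyclicOrder-asym (inj₂ (inj₁ (_ , z<x))) (inj₂ (inj₁ (_ , x<z))) = <-asym z<x x<z
CyclicOrder-asym (inj₂ (inj₁ (_ , z<x))) (inj₂ (inj₂ (x<z , _))) = <-asym z<x x<z
CyclicOrder-asym (inj₂ (inj₂ (_ , x<y))) (inj₁ (_ , y<x))        = <-asym x<y y<x
CyclicOrder-asym (inj₂ (inj₂ (_ , x<y))) (inj₂ (inj₁ (y<x , _))) = <-asym x<y y<x
CyclicOrder-asym (inj₂ (inj₂ (z<x , _))) (inj₂ (inj₂ (x<z , _))) = <-asym z<x x<z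

Residue : ℕ → ℕ → ℕ → Set
Residue n y p = (y < n × p ≡ y) ⊎ (p + n ≡ y)

%-residue : ∀ {n} .{{_ : NonZero n}} → y < n + n → Residue n y (y % n)
%-residue {y} {n} y<2n with y <? n
... | yes y<n = inj₁ (y<n , m<n⇒m%n≡m y<n)
... | no y≮n = inj₂ (begin
  y % n + n        ≡⟨ cong (_+ n) (sym (m≤n⇒[n∸m]%m≡n%m n≤y)) ⟩
  (y ∸ n) % n + n  ≡⟨ cong (_+ n) (m<n⇒m%n≡m (m<n+o⇒m∸n<o y n y<2n)) ⟩
  y ∸ n + n        ≡⟨ m∸n+n≡m n≤y ⟩
  y                ∎)
  where
  open ≡-Reasoning
  n≤y = ≮⇒≥ y≮n

m+n<n+o⇒m<o : ∀ {n} → x + n < n + y → x < y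
m+n<n+o⇒m<o {x} {y} {n} lt = +-cancelʳ-< n x y (subst (x + n <_) (+-comm n y) lt)

cyclic-residues : ∀ {n} → x < y → y < z → z < n + x →
                  Residue n x x′ → Residue n y y′ → Residue n z z′ → CyclicOrder x′ y′ z′
cyclic-residues x<y y<z _ (inj₁ (_ , refl)) (inj₁ (_ , refl)) (inj₁ (_ , refl)) =
  inj₁ (x<y , y<z)
cyclic-residues x<y _ z<n+x (inj₁ (_ , refl)) (inj₁ (_ , refl)) (inj₂ refl) =
  inj₂ (inj₂ (m+n<n+o⇒m<o z<n+x , x<y))
cyclic-residues {n = n} _ y<z z<n+x (inj₁ (_ , refl)) (inj₂ refl) (inj₂ refl) =
  inj₂ (inj₁ (+-cancelʳ-< n _ _ y<z , m+n<n+o⇒m<o z<n+x))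
cyclic-residues {n = n} x<y y<z _ (inj₂ refl) (inj₂ refl) (inj₂ refl) =
  inj₁ (+-cancelʳ-< n _ _ x<y , +-cancelʳ-< n _ _ y<z)
cyclic-residues {x′ = x′} {n = n} x<y _ _ (inj₂ refl) (inj₁ (y<n , _)) _ =
  contradiction (≤-trans (m≤n+m n x′) (<⇒≤ x<y)) (<⇒≱ y<n)
cyclic-residues {y′ = y′} {n = n} _ y<z _ _ (inj₂ refl) (inj₁ (z<n , _)) =
  contradiction (≤-trans (m≤n+m n y′) (<⇒≤ y<z)) (<⇒≱ z<n)

[m+n]%o≡[m+n%o]%o : ∀ m n o .{{_ : NonZero o}} → (m + n) % o ≡ (m + n % o) % o
[m+n]%o≡[m+n%o]%o m n o = begin
  (m + n) % o                        ≡⟨ cong (λ t → (m + t) % o) (m≡m%n+[m/n]*n n o) ⟩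
  (m + (n % o + (n / o) * o)) % o    ≡⟨ cong (_% o) (sym (+-assoc m (n % o) _)) ⟩
  (m + n % o + (n / o) * o) % o      ≡⟨ [m+kn]%n≡m%n (m + n % o) (n / o) o ⟩
  (m + n % o) % o                    ∎
  where open ≡-Reasoning

rotate-cyclic : ∀ {n a b c} s .{{_ : NonZero n}} → a < b → b < c → c < n →
                CyclicOrder ((a + s) % n) ((b + s) % n) ((c + s) % n)
rotate-cyclic {n} {a} {b} {c} s a<b b<c c<n =
  cyclic-residues (+-monoˡ-< σ a<b) (+-monoˡ-< σ b<c)
    (<-≤-trans (+-monoˡ-< σ c<n) (+-monoʳ-≤ n (m≤n+m σ a)))
    (residue (<-trans a<b (<-trans b<c c<n))) (residue (<-trans b<c c<n)) (residue c<n)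
  where
  σ = s % n
  residue : ∀ {x} → x < n → Residue n (x + σ) ((x + s) % n)
  residue {x} x<n = subst (Residue n (x + σ)) (sym ([m+n]%o≡[m+n%o]%o x s n))
    (%-residue (+-mono-< x<n (m%n<n s n)))

module Winding (Q r′ : ℕ) where

  q r n : ℕ
  q = suc Q
  r = suc r′
  n = size q r

  private variable
    c t u v w : ℕ

  r∸[r∸c]≡c : c < r → r ∸ suc (r ∸ suc c) ≡ c
  r∸[r∸c]≡c (s≤s c≤r′) = m∸[m∸n]≡n c≤r′

  coordinate-< : c < r → t < Q → c + t * r < r * Q
  coordinate-< {c} {t} c<r t<Q = begin-strict
    c + t * r  <⟨ +-monoˡ-< (t * r) c<r ⟩
    r + t * r  ≤⟨ *-monoˡ-≤ r t<Q ⟩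
    Q * r      ≡⟨ *-comm Q r ⟩
    r * Q      ∎
    where open ≤-Reasoning

  quotient-< : p < r * Q → p / r < Q
  quotient-< {p} p<rQ = m<n*o⇒m/o<n (subst (p <_) (*-comm r Q) p<rQ)

  phi-last : phi q r n ≡ 1
  phi-last with n ≟ size q r
  ... | yes _ = refl
  ... | no n≢n = contradiction refl n≢n

  phi-at : c < r → t < Q → phi q r (suc (c + t * r)) ≡ 2 + (t + (r ∸ suc c) * Q)
  phi-at {c} {t} c<r t<Q with suc (c + t * r) ≟ size q r
  ... | yes e = contradiction (suc-injective e) (<⇒≢ (coordinate-< c<r t<Q))
  ... | no _ = begin
    2 + Q * (r ∸ suc ((c + t * r) % r)) + (c + t * r ∸ (c + t * r) % r) / r
      ≡⟨ cong (λ j → 2 + Q * (r ∸ suc j) + (c + t * r ∸ j) / r) (m<n⇒[m+kn]%n≡m t c<r) ⟩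
    2 + Q * (r ∸ suc c) + (c + t * r ∸ c) / r
      ≡⟨ cong (λ d → 2 + Q * (r ∸ suc c) + d / r) (m+n∸m≡n c (t * r)) ⟩
    2 + Q * (r ∸ suc c) + t * r / r
      ≡⟨ cong (2 + Q * (r ∸ suc c) +_) (m*n/n≡m t r) ⟩
    2 + Q * (r ∸ suc c) + t
      ≡⟨ cong (2 +_) (trans (+-comm (Q * (r ∸ suc c)) t) (cong (t +_) (*-comm Q (r ∸ suc c)))) ⟩
    2 + (t + (r ∸ suc c) * Q) ∎
    where open ≡-Reasoning

  phi-suc : p < r * Q → phi q r (suc p) ≡ 2 + (p / r + (r ∸ suc (p % r)) * Q)
  phi-suc {p} p<rQ = subst (λ x → phi q r (suc x) ≡ 2 + (p / r + (r ∸ suc (p % r)) * Q))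
    (sym (m≡m%n+[m/n]*n p r)) (phi-at (m%n<n p r) (quotient-< p<rQ))

  phi-antitone-in-round : p < p′ → p′ < r * Q → p / r ≡ p′ / r → phi q r (suc p′) ≤ phi q r (suc p)
  phi-antitone-in-round {p} {p′} p<p′ p′<rQ same-round
    rewrite phi-suc (<-trans p<p′ p′<rQ) | phi-suc p′<rQ | same-round =
    s≤s (s≤s (+-monoʳ-≤ (p′ / r) (*-monoˡ-≤ Q (∸-monoʳ-≤ r′ (<⇒≤ column-<)))))
    where
    column-< : p % r < p′ % r
    column-< = +-cancelʳ-< (p / r * r) _ _ (subst₂ _<_ (m≡m%n+[m/n]*n p r)
      (trans (m≡m%n+[m/n]*n p′ r) (cong (λ t → p′ % r + t * r) (sym same-round))) p<p′)

  module _ .{{_ : NonZero Q}} where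

    position : ℕ → ℕ
    position zero = zero
    position (suc zero) = r * Q
    position (suc (suc u)) = (r ∸ suc (u / Q)) + (u % Q) * r

    round : ℕ → ℕ
    round v = position v / r

    position-at : c < r → t < Q → position (phi q r (suc (c + t * r))) ≡ c + t * r
    position-at {c} {t} c<r t<Q rewrite phi-at c<r t<Q
      | m<n⇒[m+kn]/n≡k (r ∸ suc c) t<Q | m<n⇒[m+kn]%n≡m (r ∸ suc c) t<Q =
      cong (_+ t * r) (r∸[r∸c]≡c c<r)

    position-phi : p < n → position (phi q r (suc p)) ≡ p
    position-phi {p} (s≤s p≤rQ) with m≤n⇒m<n∨m≡n p≤rQ
    ... | inj₂ refl = cong position phi-last
    ... | inj₁ p<rQ = subst (λ x → position (phi q r (suc x)) ≡ x) (sym (m≡m%n+[m/n]*n p r))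
                        (position-at (m%n<n p r) (quotient-< p<rQ))

    phi-position : 1 ≤ v → v ≤ n → phi q r (suc (position v)) ≡ v
    phi-position {suc zero} _ _ = phi-last
    phi-position {suc (suc u)} _ (s≤s 1+u≤rQ) = begin
      phi q r (suc ((r ∸ suc (u / Q)) + (u % Q) * r))
        ≡⟨ phi-at (s≤s (m∸n≤m r′ (u / Q))) (m%n<n u Q) ⟩
      2 + (u % Q + (r ∸ suc (r ∸ suc (u / Q))) * Q)
        ≡⟨ cong (λ x → 2 + (u % Q + x * Q)) (r∸[r∸c]≡c (m<n*o⇒m/o<n 1+u≤rQ)) ⟩
      2 + (u % Q + (u / Q) * Q)
        ≡⟨ cong (2 +_) (sym (m≡m%n+[m/n]*n u Q)) ⟩
      2 + u ∎
      where open ≡-Reasoning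

    position-< : 2 ≤ v → v ≤ n → position v < r * Q
    position-< {suc (suc u)} (s≤s (s≤s z≤n)) _ = coordinate-< (s≤s (m∸n≤m r′ (u / Q))) (m%n<n u Q)

    round-< : 2 ≤ v → v ≤ n → round v < Q
    round-< 2≤v v≤n = quotient-< (position-< 2≤v v≤n)

    position-injective : IsVertex q r v → IsVertex q r w → position v ≡ position w → v ≡ w
    position-injective (1≤v , v≤n) (1≤w , w≤n) eq =
      trans (sym (phi-position 1≤v v≤n)) (trans (cong (phi q r ∘ suc) eq) (phi-position 1≤w w≤n))

    round-strict : IsVertex q r v → IsVertex q r w → v < w → position v < position w → round v < round w
    round-strict (1≤v , v≤n) (_ , w≤n) v<w pv<pw =
      ≤∧≢⇒< (/-monoˡ-≤ r (<⇒≤ pv<pw)) λ same-round → <⇒≱ v<w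
        (subst₂ _≤_ (phi-position (<⇒≤ 2≤w) w≤n) (phi-position 1≤v v≤n)
          (phi-antitone-in-round pv<pw (position-< 2≤w w≤n) same-round))
      where 2≤w = ≤-trans (s≤s 1≤v) v<w

    edge⇒cyclic : ∀ {i j k} → Edge q r i j k → CyclicOrder (position i) (position j) (position k)
    edge⇒cyclic (_ , _ , _ , _ , s , suc a , suc b , suc c , _ , s≤s a<b , s≤s b<c , c<n , refl , refl , refl)
      rewrite position-phi (m%n<n (a + s) n) | position-phi (m%n<n (b + s) n)
            | position-phi (m%n<n (c + s) n) =
      rotate-cyclic s a<b b<c c<n

    module Clique {S : List ℕ} (clique : IsClique q r S) where

      vertex : v ∈ S → IsVertex q r v
      vertex = All.lookup (proj₁ (proj₂ clique))

      cyclic : ∀ {i j k} → i ∈ S → j ∈ S → k ∈ S → i < j → j < k →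
               CyclicOrder (position i) (position j) (position k)
      cyclic i∈ j∈ k∈ i<j j<k = edge⇒cyclic (proj₂ (proj₂ clique) i∈ j∈ k∈ i<j j<k)

      Wrapped : ℕ → Set
      Wrapped v = Any (λ w → w < v × position v < position w) S

      wrapped? : ∀ v → Dec (Wrapped v)
      wrapped? v = any? (λ w → (w <? v) ×-dec (position v <? position w)) S

      wrapped-downward : v ∈ S → w ∈ S → v < w → position v < position w → Wrapped w → Wrapped v
      wrapped-downward {v} {w} v∈ w∈ v<w pv<pw wrapped with find wrapped
      ... | x , x∈ , x<w , pw<px with <-cmp x v
      ...   | tri< x<v _ _ = lose x∈ (x<v , <-trans pv<pw pw<px)
      ...   | tri≈ _ refl _ = contradiction pv<pw (<-asym pw<px)
      ...   | tri> _ _ v<x =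
        contradiction (inj₂ (inj₂ (pv<pw , pw<px))) (CyclicOrder-asym (cyclic v∈ x∈ w∈ v<x x<w))

      overtaken⇒unwrapped : v ∈ S → w ∈ S → v < w → position w < position v → ¬ Wrapped v
      overtaken⇒unwrapped {v} {w} v∈ w∈ v<w pw<pv wrapped with find wrapped
      ... | x , x∈ , x<v , pv<px =
        CyclicOrder-asym (cyclic x∈ v∈ w∈ x<v v<w) (inj₁ (pw<pv , pv<px))

      key : ℕ → ℕ
      key (suc zero) = Q
      key v with wrapped? v
      ... | yes _ = round v
      ... | no _ = suc (round v)

      key-wrapped : 2 ≤ v → Wrapped v → key v ≡ round v
      key-wrapped {suc (suc u)} (s≤s (s≤s z≤n)) wrapped with wrapped? (suc (suc u))
      ... | yes _ = refl
      ... | no unwrapped = contradiction wrapped unwrapped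

      key-unwrapped : 2 ≤ v → ¬ Wrapped v → key v ≡ suc (round v)
      key-unwrapped {suc (suc u)} (s≤s (s≤s z≤n)) unwrapped with wrapped? (suc (suc u))
      ... | yes wrapped = contradiction wrapped unwrapped
      ... | no _ = refl

      key≤suc-round : 2 ≤ v → key v ≤ suc (round v)
      key≤suc-round {v} 2≤v with wrapped? v
      ... | yes wrapped = ≤-trans (≤-reflexive (key-wrapped 2≤v wrapped)) (n≤1+n (round v))
      ... | no unwrapped = ≤-reflexive (key-unwrapped 2≤v unwrapped)

      key-increasing : v ∈ S → w ∈ S → 2 ≤ v → v < w → position v < position w → key v < key w
      key-increasing {v} {w} v∈ w∈ 2≤v v<w pv<pw = by-wrapping (wrapped? w)
        where
        open ≤-Reasoning
        2≤w = ≤-trans 2≤v (<⇒≤ v<w)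
        rounds-< = round-strict (vertex v∈) (vertex w∈) v<w pv<pw
        by-wrapping : Dec (Wrapped w) → key v < key w
        by-wrapping (yes wrapped-w) = begin-strict
          key v    ≡⟨ key-wrapped 2≤v (wrapped-downward v∈ w∈ v<w pv<pw wrapped-w) ⟩
          round v  <⟨ rounds-< ⟩
          round w  ≡⟨ key-wrapped 2≤w wrapped-w ⟨
          key w    ∎
        by-wrapping (no unwrapped-w) = begin-strict
          key v          ≤⟨ key≤suc-round 2≤v ⟩
          suc (round v)  ≤⟨ rounds-< ⟩
          round w        <⟨ n<1+n (round w) ⟩
          suc (round w)  ≡⟨ key-unwrapped 2≤w unwrapped-w ⟨
          key w          ∎

      key-decreasing : v ∈ S → w ∈ S → 2 ≤ v → v < w → position w < position v → key w < key v
      key-decreasing {v} {w} v∈ w∈ 2≤v v<w pw<pv = begin-strict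
        key w          ≡⟨ key-wrapped (≤-trans 2≤v (<⇒≤ v<w)) (lose v∈ (v<w , pw<pv)) ⟩
        round w        ≤⟨ /-monoˡ-≤ r (<⇒≤ pw<pv) ⟩
        round v        <⟨ n<1+n (round v) ⟩
        suc (round v)  ≡⟨ key-unwrapped 2≤v (overtaken⇒unwrapped v∈ w∈ v<w pw<pv) ⟨
        key v          ∎
        where open ≤-Reasoning

      key-injective : v ∈ S → w ∈ S → v < w → key v ≢ key w
      key-injective {zero} v∈ _ _ with () ← proj₁ (vertex v∈)
      key-injective {suc zero} {w} v∈ w∈ 1<w eq = <⇒≢ (subst (_< Q) (sym key-w≡round-w) round-w<Q) (sym eq)
        where
        w≤n = proj₂ (vertex w∈)
        key-w≡round-w = key-wrapped 1<w (lose v∈ (1<w , position-< 1<w w≤n))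
        round-w<Q = round-< 1<w w≤n
      key-injective {v@(suc (suc _))} {w} v∈ w∈ v<w with <-cmp (position v) (position w)
      ... | tri< pv<pw _ _ = <⇒≢ (key-increasing v∈ w∈ (s≤s (s≤s z≤n)) v<w pv<pw)
      ... | tri≈ _ pv≡pw _ = contradiction (position-injective (vertex v∈) (vertex w∈) pv≡pw) (<⇒≢ v<w)
      ... | tri> _ _ pw<pv = >⇒≢ (key-decreasing v∈ w∈ (s≤s (s≤s z≤n)) v<w pw<pv)

      key-< : v ∈ S → key v < q
      key-< {zero} v∈ with () ← proj₁ (vertex v∈)
      key-< {suc zero} _ = n<1+n Q
      key-< {v@(suc (suc _))} v∈ = s≤s (≤-trans (key≤suc-round 2≤v) (round-< 2≤v (proj₂ (vertex v∈))))
        where 2≤v = s≤s (s≤s z≤n)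

      clique-size-≤ : length S ≤ q
      clique-size-≤ = length≤-of-injectiveOn key (proj₁ clique) key-< key-injectiveOn
        where
        key-injectiveOn : ∀ {x y} → x ∈ S → y ∈ S → key x ≡ key y → x ≡ y
        key-injectiveOn {v} {w} v∈ w∈ eq with <-cmp v w
        ... | tri< v<w _ _ = contradiction eq (key-injective v∈ w∈ v<w)
        ... | tri≈ _ v≡w _ = v≡w
        ... | tri> _ _ w<v = contradiction (sym eq) (key-injective w∈ v∈ w<v)

  winding-position : ∀ {a} → a < q → rot q r (r * Q) (suc (a * r)) ≡ suc a
  winding-position {zero} _ = trans (cong (phi q r ∘ suc) (m<n⇒m%n≡m (n<1+n (r * Q)))) phi-last
  winding-position {suc b} (s≤s b<Q) = begin
    phi q r (suc ((r + b * r + r * Q) % n))  ≡⟨ cong (phi q r ∘ suc) wrap ⟩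
    phi q r (suc (r′ + b * r))               ≡⟨ phi-at ≤-refl b<Q ⟩
    2 + (b + (r′ ∸ r′) * Q)                  ≡⟨ cong (λ x → 2 + (b + x * Q)) (n∸n≡0 r′) ⟩
    2 + (b + 0)                              ≡⟨ cong (2 +_) (+-identityʳ b) ⟩
    2 + b                                    ∎
    where
    open ≡-Reasoning
    wrap : (r + b * r + r * Q) % n ≡ r′ + b * r
    wrap = begin
      (r + b * r + r * Q) % n    ≡⟨ cong (_% n) (sym (+-suc (r′ + b * r) (r * Q))) ⟩
      (r′ + b * r + n) % n       ≡⟨ [m+n]%n≡m%n (r′ + b * r) n ⟩
      (r′ + b * r) % n           ≡⟨ m<n⇒m%n≡m (m<n⇒m<1+n (coordinate-< ≤-refl b<Q)) ⟩
      r′ + b * r                 ∎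

  clique-of-size-q : Σ (List ℕ) λ S → IsClique q r S × length S ≡ q
  clique-of-size-q = applyDownFrom suc q , (unique , All.tabulate vertex , edge) , length-applyDownFrom suc q
    where
    unique : Unique (applyDownFrom suc q)
    unique = applyDownFrom⁺₁ suc q λ j<i _ → >⇒≢ (s≤s j<i)
    vertex : ∀ {v} → v ∈ applyDownFrom suc q → IsVertex q r v
    vertex v∈ with a , s≤s a≤Q , refl ← ∈-applyDownFrom⁻ suc v∈ = s≤s z≤n , s≤s (≤-trans a≤Q (m≤n*m Q r))
    edge : ∀ {i j k} → i ∈ applyDownFrom suc q → j ∈ applyDownFrom suc q → k ∈ applyDownFrom suc q →
           i < j → j < k → Edge q r i j k
    edge i∈ j∈ k∈ i<j j<k
      with a , a<q , refl ← ∈-applyDownFrom⁻ suc i∈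
         | b , b<q , refl ← ∈-applyDownFrom⁻ suc j∈
         | c , s≤s c≤Q , refl ← ∈-applyDownFrom⁻ suc k∈ =
      i<j , j<k , vertex i∈ , vertex k∈ ,
      r * Q , suc (a * r) , suc (b * r) , suc (c * r) ,
      s≤s z≤n , s≤s (*-monoˡ-< r (s<s⁻¹ i<j)) , s≤s (*-monoˡ-< r (s<s⁻¹ j<k)) ,
      s≤s (subst (c * r ≤_) (*-comm Q r) (*-monoˡ-≤ r c≤Q)) ,
      winding-position a<q , winding-position b<q , winding-position (s≤s c≤Q)

single-vertex-clique-size-≤ : ∀ r′ {S} → IsClique 1 (suc r′) S → length S ≤ 1
single-vertex-clique-size-≤ r′ {S} (unique , vertices , _) =
  length≤-of-injectiveOn (λ _ → 0) unique (λ _ → s≤s z≤n) λ v∈ w∈ _ → trans (≡1 v∈) (sym (≡1 w∈))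
  where
  ≡1 : ∀ {v} → v ∈ S → v ≡ 1
  ≡1 {v} v∈ with 1≤v , v≤n ← All.lookup vertices v∈ =
    ≤-antisym (subst (v ≤_) (cong suc (*-zeroʳ (suc r′))) v≤n) 1≤v

clique-size-≤ : ∀ Q r′ {S} → IsClique (suc Q) (suc r′) S → length S ≤ suc Q
clique-size-≤ zero r′ = single-vertex-clique-size-≤ r′
clique-size-≤ (suc Q) r′ = Winding.Clique.clique-size-≤ (suc Q) r′

lemma3 : (q r : ℕ) → .{{_ : NonZero r}} → 1 ≤ q → CliqueNumberIs q r q
lemma3 zero _ ()
lemma3 (suc Q) (suc r′) _ = Winding.clique-of-size-q Q r′ , λ S → clique-size-≤ Q r′
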